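{- Let $V$ be an $m\times n$ $(0,1)$-matrix and $B$ a $p\times q$ $(0,1)$-matrix, let $L=\begin{bmatrix}0 & V\\ V^T & 0\end{bmatrix}$, $H=\begin{bmatrix}0 & B\\ B^T & 0\end{bmatrix}$, $H^{\#}=\begin{bmatrix}0 & B^T\\ B & 0\end{bmatrix}$, and suppose the bipartite graphs $G_L$ and $G_H$ have no isolated vertices. If $G_L$ and $G_H$ are connected, then $G_L$ and $G_H$ have property $\eta$.
   Context: For a symmetric $(0,1)$-matrix $A$ with zero diagonal, $G_A$ is the simple graph with adjacency matrix $A$; so $G_L$ (resp. $G_H$) is the bipartite graph with biadjacency matrix $V$ (resp. $B$). The partitioned tensor product of $2\times 2$ block matrices is $\begin{bmatrix}U & V'\\ W & X\end{bmatrix}\underline{\otimes}\begin{bmatrix}A & B'\\ C & D\end{bmatrix}=\begin{bmatrix}U\otimes A & V'\otimes B'\\ W\otimes C & X\otimes D\end{bmatrix}$ ($\otimes$ the Kronecker product), so $L\underline{\otimes}H=\begin{bmatrix}0 & V\otimes B\\ V^T\otimes B^T & 0\end{bmatrix}$ and $L\underline{\otimes}H^{\#}=\begin{bmatrix}0 & V\otimes B^T\\ V^T\otimes B & 0\end{bmatrix}$. The canonical bipartition of $G_{L\underline{\otimes}H}$ is $X_1\cup Y_1$, with $X_1$ the first $mp$ vertices (rows of $V\otimes B$) and $Y_1$ the last $nq$ vertices; that of $G_{L\underline{\otimes}H^{\#}}$ is $X_2\cup Y_2$, with $X_2$ the first $mq$ vertices (rows of $V\otimes B^T$) and $Y_2$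 the last $np$ vertices. An isomorphism $f$ from $G_{L\underline{\otimes}H}$ to $G_{L\underline{\otimes}H^{\#}}$ respects the partite sets if either $f(X_1)=X_2,f(Y_1)=Y_2$ or $f(X_1)=Y_2,f(Y_1)=X_2$. The graphs $G_L$ and $G_H$ have property $\eta$ if, whenever $G_{L\underline{\otimes}H}$ and $G_{L\underline{\otimes}H^{\#}}$ are isomorphic, there exists an isomorphism between them that respects the partite sets of the canonical bipartitions. -}

module Defs where

open import Data.Bool using (Bool; true; false; _∧_; T)
open import Data.Fin using (Fin)
open import Data.Sum using (_⊎_; inj₁; inj₂)
open import Data.Product using (_×_; _,_; Σ; ∃)
open import Function.Bundles using (_↔_; Inverse)
open import Relation.Binary.PropositionalEquality using (_≡_)
open import Relation.Binary.Construct.Closure.ReflexiveTransitive using (Star)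

Matrix01 : Set → Set → Set
Matrix01 X Y = X → Y → Bool

transpose : {X Y : Set} → Matrix01 X Y → Matrix01 Y X
transpose M y x = M x y

-- Kronecker product; row (i,k) corresponds to row index i*p+k, column (j,l) to j*q+l.
kron : {X Y Z W : Set} → Matrix01 X Y → Matrix01 Z W → Matrix01 (X × Z) (Y × W)
kron V B (i , k) (j , l) = V i j ∧ B k l

-- Adjacency matrix [[0, M],[M^T, 0]] on the vertex set X ⊎ Y
-- (inj₁ = first block of rows/columns, inj₂ = second block).
bipAdj : {X Y : Set} → Matrix01 X Y → (X ⊎ Y) → (X ⊎ Y) → Bool
bipAdj M (inj₁ x) (inj₁ x') = false
bipAdj M (inj₁ x) (inj₂ y)  = M x y
bipAdj M (inj₂ y) (inj₁ x)  = M x y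
bipAdj M (inj₂ y) (inj₂ y') = false

Edge : {A : Set} → (A → A → Bool) → A → A → Set
Edge adj u v = T (adj u v)

Connected : {A : Set} → (A → A → Bool) → Set
Connected {A} adj = (u v : A) → Star (Edge adj) u v

NoIsolated : {A : Set} → (A → A → Bool) → Set
NoIsolated {A} adj = (u : A) → ∃ λ v → Edge adj u v

IsIso : {A B : Set} → (A → A → Bool) → (B → B → Bool) → (A ↔ B) → Set
IsIso {A} adjA adjB f = (u v : A) → adjA u v ≡ adjB (Inverse.to f u) (Inverse.to f v)

Isomorphic : {A B : Set} → (A → A → Bool) → (B → B → Bool) → Set
Isomorphic {A} {B} adjA adjB = Σ (A ↔ B) (IsIso adjA adjB)

data IsLeft {X Y : Set} : X ⊎ Y → Set where
  left : (x : X) → IsLeft (inj₁ x)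

data IsRight {X Y : Set} : X ⊎ Y → Set where
  right : (y : Y) → IsRight (inj₂ y)

-- f(X₁) = X₂ and f(Y₁) = Y₂, or f(X₁) = Y₂ and f(Y₁) = X₂.
-- (Since f is a bijection X₁⊎Y₁ → X₂⊎Y₂, the inclusions below are equivalent to equalities.)
RespectsParts : {X₁ Y₁ X₂ Y₂ : Set} → ((X₁ ⊎ Y₁) ↔ (X₂ ⊎ Y₂)) → Set
RespectsParts {X₁} {Y₁} f =
  (((x : X₁) → IsLeft (Inverse.to f (inj₁ x))) × ((y : Y₁) → IsRight (Inverse.to f (inj₂ y))))
  ⊎ (((x : X₁) → IsRight (Inverse.to f (inj₁ x))) × ((y : Y₁) → IsLeft (Inverse.to f (inj₂ y))))

-- Property η for G_L (biadjacency V, m×n) and G_H (biadjacency B, p×q):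
-- G_{L⊗H} has biadjacency V⊗B, G_{L⊗H#} has biadjacency V⊗Bᵀ.
PropertyEta : {m n p q : Set} → Matrix01 m n → Matrix01 p q → Set
PropertyEta V B =
  Isomorphic (bipAdj (kron V B)) (bipAdj (kron V (transpose B))) →
  Σ _ λ f → IsIso (bipAdj (kron V B)) (bipAdj (kron V (transpose B))) f × RespectsParts f

{-# OPTIONS --safe #-}
module Submission where

open import Defs
open import Data.Nat using (ℕ; zero; suc)
open import Data.Fin using (Fin; zero)
open import Data.Fin.Properties using (¬Fin0)
open import Data.Bool using (Bool; true; false; not; _∧_; _xor_; T)
open import Data.Bool.Properties using (not-involutive)
open import Data.Unit using (tt)
open import Data.Empty using (⊥-elim)
open import Data.Sum using (_⊎_; inj₁; inj₂; swap)
open import Data.Product using (_×_; _,_; Σ)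
open import Function.Base using (_on_)
open import Function.Bundles using (_↔_; Inverse)
open import Relation.Nullary using (Dec; yes; no; ¬_; _×-dec_; _⊎-dec_)
open import Relation.Binary.PropositionalEquality
  using (_≡_; refl; sym; trans; cong; cong₂; subst; module ≡-Reasoning)
open import Relation.Binary.Construct.Closure.ReflexiveTransitive
  using (Star; ε; _◅_; _◅◅_; fold)

-- The vertices (a, b) of G_{L⊗H} are the pairs of vertices of G_L and G_H lying on the same side,
-- and (a, b) ~ (a', b') exactly when a ~ a' and b ~ b'.  Walking in one factor while oscillating
-- along a fixed edge of the other shows that G_{L⊗H} is connected.  For an isomorphism of bipartite
-- graphs, whether it keeps or swaps the side of a vertex is invariant along edges, so on a connected
-- graph it is the same for all vertices: the isomorphism respects the partite sets.

T-∧ : ∀ {x y} → T x → T y → T (x ∧ y)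
T-∧ {true} {true} _ _ = tt

not-xor-not : ∀ a b → not a xor not b ≡ a xor b
not-xor-not false b = not-involutive b
not-xor-not true  b = refl

xor-cancelʳ : ∀ a b → (a xor b) xor b ≡ a
xor-cancelʳ false false = refl
xor-cancelʳ false true  = refl
xor-cancelʳ true  false = refl
xor-cancelʳ true  true  = refl

walk-invariant : ∀ {A C : Set} {E : A → A → Set} (g : A → C) →
  (∀ {u v} → E u v → g u ≡ g v) → ∀ {u v} → Star E u v → g u ≡ g v
walk-invariant g edge-invariant = fold (_≡_ on g) (λ e → trans (edge-invariant e)) refl

Fin-inhabited? : ∀ n → Dec (Fin n)
Fin-inhabited? zero    = no ¬Fin0
Fin-inhabited? (suc n) = yes zero

module _ {X Y : Set} where

  side : X ⊎ Y → Bool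
  side (inj₁ _) = true
  side (inj₂ _) = false

  isLeft : ∀ w → side w ≡ true → IsLeft w
  isLeft (inj₁ x) _ = left x

  isRight : ∀ w → side w ≡ false → IsRight w
  isRight (inj₂ y) _ = right y

  module _ {M : Matrix01 X Y} where

    bipEdge-sym : ∀ {u v} → Edge (bipAdj M) u v → Edge (bipAdj M) v u
    bipEdge-sym {inj₁ x} {inj₂ y} e = e
    bipEdge-sym {inj₂ y} {inj₁ x} e = e

    bipEdge-side : ∀ {u v} → Edge (bipAdj M) u v → side v ≡ not (side u)
    bipEdge-side {inj₁ x} {inj₂ y} _ = refl
    bipEdge-side {inj₂ y} {inj₁ x} _ = refl

module _ {X₁ Y₁ X₂ Y₂ : Set} {M : Matrix01 X₁ Y₁} {N : Matrix01 X₂ Y₂}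
         (f : (X₁ ⊎ Y₁) ↔ (X₂ ⊎ Y₂)) (f-iso : IsIso (bipAdj M) (bipAdj N) f) where

  private
    to = Inverse.to f

  twist : X₁ ⊎ Y₁ → Bool
  twist u = side (to u) xor side u

  twist-edge-invariant : ∀ {u v} → Edge (bipAdj M) u v → twist u ≡ twist v
  twist-edge-invariant {u} {v} e = begin
    side (to u) xor side u             ≡⟨ sym (not-xor-not (side (to u)) (side u)) ⟩
    not (side (to u)) xor not (side u) ≡⟨ cong₂ _xor_ (sym (bipEdge-side {M = N} {to u} {to v} e′))
                                                      (sym (bipEdge-side {M = M} {u} {v} e)) ⟩
    side (to v) xor side v             ∎
    where
    open ≡-Reasoning
    e′ : Edge (bipAdj N) (to u) (to v)
    e′ = subst T (f-iso u v) e

  side-image : ∀ u → side (to u) ≡ twist u xor side u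
  side-image u = sym (xor-cancelʳ (side (to u)) (side u))

  respectsParts-twisting : ∀ c → (∀ u → twist u ≡ c) → RespectsParts f
  respectsParts-twisting false twist≡ =
    inj₁ ((λ x → isLeft _ (image (inj₁ x))) , (λ y → isRight _ (image (inj₂ y))))
    where
    image : ∀ u → side (to u) ≡ false xor side u
    image u = trans (side-image u) (cong (_xor side u) (twist≡ u))
  respectsParts-twisting true twist≡ =
    inj₂ ((λ x → isRight _ (image (inj₁ x))) , (λ y → isLeft _ (image (inj₂ y))))
    where
    image : ∀ u → side (to u) ≡ true xor side u
    image u = trans (side-image u) (cong (_xor side u) (twist≡ u))

  connected-iso-respectsParts : Connected (bipAdj M) → Dec (X₁ ⊎ Y₁) → RespectsParts f
  connected-iso-respectsParts connected (yes u₀) =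
    respectsParts-twisting (twist u₀)
      (λ u → sym (walk-invariant twist twist-edge-invariant (connected u₀ u)))
  connected-iso-respectsParts connected (no empty) =
    inj₁ ((λ x → ⊥-elim (empty (inj₁ x))) , (λ y → ⊥-elim (empty (inj₂ y))))

module _ {X Y Z W : Set} where

  data SameSide : X ⊎ Y → Z ⊎ W → Set where
    lefts  : ∀ i k → SameSide (inj₁ i) (inj₁ k)
    rights : ∀ j l → SameSide (inj₂ j) (inj₂ l)

  module _ (V : Matrix01 X Y) (B : Matrix01 Z W) where

    private
      EL = Edge (bipAdj V)
      EH = Edge (bipAdj B)
      E  = Edge (bipAdj (kron V B))

    pair : ∀ {a b} → SameSide a b → (X × Z) ⊎ (Y × W)
    pair (lefts i k)  = inj₁ (i , k)
    pair (rights j l) = inj₂ (j , l)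

    kron-step : ∀ {a a′ b b′} → EL a a′ → EH b b′ → (s : SameSide a b) →
      Σ (SameSide a′ b′) λ s′ → E (pair s) (pair s′)
    kron-step {a′ = inj₂ j} {b′ = inj₂ l} eL eH (lefts i k)  = rights j l , T-∧ eL eH
    kron-step {a′ = inj₁ i} {b′ = inj₁ k} eL eH (rights j l) = lefts i k , T-∧ eL eH

    ¬sameSide-edgeˡ : ∀ {a a′ b} → EL a a′ → SameSide a b → ¬ SameSide a′ b
    ¬sameSide-edgeˡ () (lefts i k) (lefts i′ .k)
    ¬sameSide-edgeˡ () (rights j l) (rights j′ .l)

    ¬sameSide-edgeʳ : ∀ {a b b′} → EH b b′ → SameSide a b → ¬ SameSide a b′
    ¬sameSide-edgeʳ () (lefts i k) (lefts .i k′)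
    ¬sameSide-edgeʳ () (rights j l) (rights .j l′)

    sameSide-endpoint : ∀ c {b b′} → EH b b′ → Σ (Z ⊎ W) λ y → (y ≡ b ⊎ y ≡ b′) × SameSide c y
    sameSide-endpoint (inj₁ i) {inj₁ k} {inj₂ l} _ = inj₁ k , inj₁ refl , lefts i k
    sameSide-endpoint (inj₁ i) {inj₂ l} {inj₁ k} _ = inj₁ k , inj₂ refl , lefts i k
    sameSide-endpoint (inj₂ j) {inj₁ k} {inj₂ l} _ = inj₂ l , inj₂ refl , rights j l
    sameSide-endpoint (inj₂ j) {inj₂ l} {inj₁ k} _ = inj₂ l , inj₁ refl , rights j l

    lift-walkʳ : ∀ {a a′ b b′ x} → EL a a′ → Star EH b b′ → (s : SameSide a b) →
      x ≡ a ⊎ x ≡ a′ → (t : SameSide x b′) → Star E (pair s) (pair t)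
    lift-walkʳ _ ε (lefts i k)  (inj₁ refl) (lefts .i .k)  = ε
    lift-walkʳ _ ε (rights j l) (inj₁ refl) (rights .j .l) = ε
    lift-walkʳ e ε s (inj₂ refl) t = ⊥-elim (¬sameSide-edgeˡ e s t)
    lift-walkʳ {a} {a′} e (eH ◅ w) s x∈e t =
      let s′ , step = kron-step e eH s
      in step ◅ lift-walkʳ (bipEdge-sym {M = V} {a} {a′} e) w s′ (swap x∈e) t

    lift-walkˡ : ∀ {a a′ b b′ y} → EH b b′ → Star EL a a′ → (s : SameSide a b) →
      y ≡ b ⊎ y ≡ b′ → (t : SameSide a′ y) → Star E (pair s) (pair t)
    lift-walkˡ _ ε (lefts i k)  (inj₁ refl) (lefts .i .k)  = ε
    lift-walkˡ _ ε (rights j l) (inj₁ refl) (rights .j .l) = ε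
    lift-walkˡ e ε s (inj₂ refl) t = ⊥-elim (¬sameSide-edgeʳ e s t)
    lift-walkˡ {b = b} {b′} e (eL ◅ w) s y∈e t =
      let s′ , step = kron-step eL e s
      in step ◅ lift-walkˡ (bipEdge-sym {M = B} {b} {b′} e) w s′ (swap y∈e) t

    module _ (noIsolatedL : NoIsolated (bipAdj V)) (noIsolatedH : NoIsolated (bipAdj B))
             (connectedL : Connected (bipAdj V)) (connectedH : Connected (bipAdj B)) where

      kron-reachable : ∀ {a b c d} (s : SameSide a b) (t : SameSide c d) → Star E (pair s) (pair t)
      kron-reachable {a} {b} {c} {d} s t =
        let _ , eH         = noIsolatedH b
            _ , eL         = noIsolatedL c
            y , y∈eH , s′ = sameSide-endpoint c eH
        in lift-walkˡ eH (connectedL a c) s y∈eH s′ ◅◅ lift-walkʳ eL (connectedH y d) s′ (inj₁ refl) t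

      kron-connected : Connected (bipAdj (kron V B))
      kron-connected (inj₁ (i , k)) (inj₁ (i′ , k′)) = kron-reachable (lefts i k) (lefts i′ k′)
      kron-connected (inj₁ (i , k)) (inj₂ (j′ , l′)) = kron-reachable (lefts i k) (rights j′ l′)
      kron-connected (inj₂ (j , l)) (inj₁ (i′ , k′)) = kron-reachable (rights j l) (lefts i′ k′)
      kron-connected (inj₂ (j , l)) (inj₂ (j′ , l′)) = kron-reachable (rights j l) (rights j′ l′)

theorem4p4 : (m n p q : ℕ) (V : Matrix01 (Fin m) (Fin n)) (B : Matrix01 (Fin p) (Fin q)) →
    NoIsolated (bipAdj V) → NoIsolated (bipAdj B) →
    Connected (bipAdj V) → Connected (bipAdj B) →
    PropertyEta V B
theorem4p4 m n p q V B noIsolatedL noIsolatedH connectedL connectedH (f , f-iso) =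
  f , f-iso , connected-iso-respectsParts f f-iso
    (kron-connected V B noIsolatedL noIsolatedH connectedL connectedH)
    ((Fin-inhabited? m ×-dec Fin-inhabited? p) ⊎-dec (Fin-inhabited? n ×-dec Fin-inhabited? q))
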